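{- Let $G$ be a maximal outerplane graph with maximum degree $\Delta(G)\geq 2$. Then $gp(G)\geq \left\lfloor\frac{2(\Delta(G)+1)}{3}\right\rfloor$.
   Context: All graphs are finite, simple, undirected and connected. A set $R\subseteq V(G)$ is a general position set of $G$ if no three distinct vertices of $R$ are such that one of them lies on a shortest path (geodesic) in $G$ between the other two. The general position number $gp(G)$ is the maximum cardinality of a general position set of $G$. A graph is outerplanar if it can be embedded in the plane with all vertices on the boundary of the outer face; it is maximal outerplanar if adding any edge between two non-adjacent vertices destroys outerplanarity. A maximal outerplane graph is a maximal outerplanar graph together with such an embedding. $\Delta(G)$ denotes the maximum degree of $G$. -}

module Defs where

open import Data.Nat using (ℕ; zero; suc; _+_; _≤_; _<_; _⊔_)
open import Data.Bool using (Bool; true; false; if_then_else_; _∨_; _∧_)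
open import Data.Fin using (Fin; _≟_) renaming (_<_ to _<ᶠ_)
open import Data.Fin.Subset using (Subset; _∈_; ∣_∣)
open import Data.List using (List; map; foldr; allFin)
open import Data.Nat.ListAction using (sum)
open import Data.Product using (Σ; ∃; _×_; _,_)
open import Relation.Binary.PropositionalEquality using (_≡_; _≢_)
open import Relation.Nullary using (¬_)
open import Relation.Nullary.Decidable using (⌊_⌋)
open import Function.Definitions using (Injective)

Adj : ℕ → Set
Adj n = Fin n → Fin n → Bool

record Graph (n : ℕ) : Set where
  field
    adj   : Adj n
    sym   : ∀ u v → adj u v ≡ adj v u
    irrefl : ∀ v → adj v v ≡ false
open Graph public

data Walk {n : ℕ} (A : Adj n) : Fin n → Fin n → ℕ → Set where
  nil  : ∀ {u} → Walk A u u 0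
  cons : ∀ {u v w k} → A u v ≡ true → Walk A v w k → Walk A u w (suc k)

data Visits {n : ℕ} {A : Adj n} (x : Fin n) : ∀ {u w k} → Walk A u w k → Set where
  here-nil  : Visits x (nil {u = x})
  here-cons : ∀ {v w k} (e : A x v ≡ true) (p : Walk A v w k) → Visits x (cons e p)
  there     : ∀ {u v w k} (e : A u v ≡ true) {p : Walk A v w k} → Visits x p → Visits x (cons e p)

Connected : ∀ {n} → Graph n → Set
Connected G = ∀ u v → ∃ λ k → Walk (adj G) u v k

IsShortest : ∀ {n} (G : Graph n) {u v k} → Walk (adj G) u v k → Set
IsShortest G {u} {v} {k} _ = ∀ m → Walk (adj G) u v m → k ≤ m

OnGeodesic : ∀ {n} (G : Graph n) → Fin n → Fin n → Fin n → Set
OnGeodesic G u v x =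
  Σ ℕ λ k → Σ (Walk (adj G) u v k) λ p → IsShortest G p × Visits x p

GeneralPosition : ∀ {n} → Graph n → Subset n → Set
GeneralPosition G R =
  ∀ u v x → u ∈ R → v ∈ R → x ∈ R → u ≢ v → u ≢ x → v ≢ x → ¬ OnGeodesic G u v x

gp≥ : ∀ {n} → Graph n → ℕ → Set
gp≥ {n} G k = Σ (Subset n) λ R → GeneralPosition G R × k ≤ ∣ R ∣

deg : ∀ {n} → Graph n → Fin n → ℕ
deg {n} G v = sum (map (λ u → if adj G v u then 1 else 0) (allFin n))

maxDeg : ∀ {n} → Graph n → ℕ
maxDeg {n} G = foldr (λ v m → deg G v ⊔ m) 0 (allFin n)

-- Outerplanarity (combinatorial form): the vertices can be placed in a cyclic
-- order on a circle (positions given by an injective π : Fin n → Fin n)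
-- such that no two edges, drawn as chords, cross.
Outerplanar : ∀ {n} → Adj n → Set
Outerplanar {n} A =
  Σ (Fin n → Fin n) λ π → Injective _≡_ _≡_ π ×
    (∀ a b c d → A a b ≡ true → A c d ≡ true →
       ¬ (π a <ᶠ π c × π c <ᶠ π b × π b <ᶠ π d))

addEdge : ∀ {n} → Adj n → Fin n → Fin n → Adj n
addEdge A u v x y =
  A x y ∨ (⌊ x ≟ u ⌋ ∧ ⌊ y ≟ v ⌋) ∨ (⌊ x ≟ v ⌋ ∧ ⌊ y ≟ u ⌋)

MaximalOuterplanar : ∀ {n} → Graph n → Set
MaximalOuterplanar G =
  Outerplanar (adj G) ×
  (∀ u v → u ≢ v → adj G u v ≡ false → ¬ Outerplanar (addEdge (adj G) u v))

{-# OPTIONS --safe #-}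
-- List the neighbours of a vertex v in the cyclic order of the outerplanar embedding, starting
-- just after v. A chord between two neighbours that are not consecutive in this list would cross
-- the edge from v to a neighbour lying between them, so the neighbours induce a subgraph of a
-- path. Keeping two out of every three consecutive neighbours leaves no path u–x–w inside the
-- kept set. Two neighbours of v are at distance at most 2, so a vertex on a geodesic between
-- them is adjacent to both; hence the kept set, of size at least ⌊2(deg v + 1)/3⌋, is in general
-- position. Taking v of maximum degree gives the theorem.
module Submission where

open import Data.Bool using (Bool; true; false; if_then_else_)
open import Data.Bool.Properties using () renaming (_≟_ to _≟ᵇ_)
open import Data.Fin using (Fin; toℕ) renaming (_<_ to _<ᶠ_)
open import Data.Fin.Properties using (toℕ<n; toℕ-injective)
open import Data.Fin.Subset using (Subset; ∣_∣; ⁅_⁆; _∪_) renaming (_∈_ to _∈ₛ_; ⊥ to ∅)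
open import Data.Fin.Subset.Properties
  using (∉⊥; x∈p∪q⁻; x∈⁅y⁆⇒x≡y; x∈⁅x⁆; p⊆p∪q; q⊆p∪q; p⊂q⇒∣p∣<∣q∣)
open import Data.Nat using (ℕ; suc; _+_; _*_; _≤_; _<_; _<ᵇ_; _/_; z≤n; s≤s; _⊔_)
open import Data.Nat.ListAction using (sum)
open import Data.Nat.DivMod using (+-distrib-/-∣ˡ)
open import Data.Nat.Divisibility using (divides-refl)
open import Data.Nat.Properties
open import Data.List using (List; []; _∷_; _++_; length; filter; foldr; map; allFin)
open import Data.List.Membership.Propositional using (_∈_)
open import Data.List.Membership.Propositional.Properties using (∈-++⁻)
open import Data.List.Relation.Unary.Any using (here; there)
open import Data.List.Relation.Unary.All as All using (All; []; _∷_)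
open import Data.List.Relation.Unary.All.Properties using (all-filter)
open import Data.List.Relation.Unary.AllPairs as AllPairs using (AllPairs; []; _∷_)
open import Data.List.Relation.Unary.Linked.Properties using (Linked⇒AllPairs)
open import Data.List.Relation.Unary.Unique.Propositional.Properties using (allFin⁺; filter⁺)
open import Data.List.Relation.Binary.Permutation.Propositional using (↭-sym; ↭⇒↭ₛ)
open import Data.List.Relation.Binary.Permutation.Propositional.Properties using (All-resp-↭; ↭-length)
open import Data.List.Relation.Binary.Permutation.Setoid.Properties using (Unique-resp-↭)
import Data.List.Sort as Sort
open import Data.Product using (∃; _×_; _,_)
open import Data.Sum using (inj₁; inj₂)
open import Data.Empty using (⊥; ⊥-elim)
open import Relation.Nullary using (¬_; ofʸ; ofⁿ)
open import Function.Definitions using (Injective)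
open import Relation.Binary using (Symmetric)
import Relation.Binary.Construct.On as On
open import Relation.Binary.PropositionalEquality
open import Defs hiding (sym)

module _ {A : Set} where

  dropEveryThird : List A → List A
  dropEveryThird (a ∷ b ∷ c ∷ r) = a ∷ b ∷ dropEveryThird r
  dropEveryThird []              = []
  dropEveryThird (a ∷ [])        = a ∷ []
  dropEveryThird (a ∷ b ∷ [])    = a ∷ b ∷ []

  ∈-dropEveryThird⁻ : ∀ xs {x} → x ∈ dropEveryThird xs → x ∈ xs
  ∈-dropEveryThird⁻ (a ∷ b ∷ c ∷ r) (here p)         = here p
  ∈-dropEveryThird⁻ (a ∷ b ∷ c ∷ r) (there (here p)) = there (here p)
  ∈-dropEveryThird⁻ (a ∷ b ∷ c ∷ r) (there (there p)) =
    there (there (there (∈-dropEveryThird⁻ r p)))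
  ∈-dropEveryThird⁻ (a ∷ [])        p = p
  ∈-dropEveryThird⁻ (a ∷ b ∷ [])    p = p

  All-dropEveryThird : ∀ {P : A → Set} xs → All P xs → All P (dropEveryThird xs)
  All-dropEveryThird xs pxs = All.tabulate (λ x∈ → All.lookup pxs (∈-dropEveryThird⁻ xs x∈))

  AllPairs-dropEveryThird : ∀ {R : A → A → Set} xs → AllPairs R xs → AllPairs R (dropEveryThird xs)
  AllPairs-dropEveryThird (a ∷ b ∷ c ∷ r) ((ab ∷ _ ∷ ar) ∷ (_ ∷ br) ∷ _ ∷ rr) =
    (ab ∷ All-dropEveryThird r ar) ∷ All-dropEveryThird r br ∷ AllPairs-dropEveryThird r rr
  AllPairs-dropEveryThird []           rs = rs
  AllPairs-dropEveryThird (a ∷ [])     rs = rs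
  AllPairs-dropEveryThird (a ∷ b ∷ []) rs = rs

  length-dropEveryThird : ∀ xs → 2 * suc (length xs) / 3 ≤ length (dropEveryThird xs)
  length-dropEveryThird (a ∷ b ∷ c ∷ r) = begin
      2 * (3 + suc m) / 3           ≡⟨ cong (_/ 3) (*-distribˡ-+ 2 3 (suc m)) ⟩
      (6 + 2 * suc m) / 3           ≡⟨ +-distrib-/-∣ˡ (2 * suc m) {3} (divides-refl 2) ⟩
      2 + 2 * suc m / 3             ≤⟨ +-monoʳ-≤ 2 (length-dropEveryThird r) ⟩
      2 + length (dropEveryThird r) ∎
    where
      open ≤-Reasoning
      m : ℕ
      m = length r
  length-dropEveryThird []           = z≤n
  length-dropEveryThird (a ∷ [])     = s≤s z≤n
  length-dropEveryThird (a ∷ b ∷ []) = s≤s (s≤s z≤n)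

module _ {A : Set} (R : A → A → Set) where

  PathFree : List A → Set
  PathFree xs = ∀ {u x w} → u ∈ xs → x ∈ xs → w ∈ xs →
    u ≢ w → u ≢ x → w ≢ x → R u x → R x w → ⊥

  pathFree-[] : PathFree []
  pathFree-[] ()

  pathFree-[_] : ∀ a → PathFree (a ∷ [])
  pathFree-[ a ] (here refl) (here refl) _ _ u≢x _ _ _ = u≢x refl

  pathFree-[_,_] : ∀ a b → PathFree (a ∷ b ∷ [])
  pathFree-[ a , b ] (here refl)         (here refl)         _                   _   u≢x _   _ _ = u≢x refl
  pathFree-[ a , b ] (there (here refl)) (there (here refl)) _                   _   u≢x _   _ _ = u≢x refl
  pathFree-[ a , b ] (here refl)         (there (here refl)) (here refl)         u≢w _   _   _ _ = u≢w refl
  pathFree-[ a , b ] (here refl)         (there (here refl)) (there (here refl)) _   _   w≢x _ _ = w≢x refl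
  pathFree-[ a , b ] (there (here refl)) (here refl)         (here refl)         _   _   w≢x _ _ = w≢x refl
  pathFree-[ a , b ] (there (here refl)) (here refl)         (there (here refl)) u≢w _   _   _ _ = u≢w refl

  Unlinked : List A → List A → Set
  Unlinked ys zs = ∀ {y z} → y ∈ ys → z ∈ zs → ¬ R y z

  pathFree-++ : Symmetric R → ∀ ys {zs} → PathFree ys → PathFree zs → Unlinked ys zs →
    PathFree (ys ++ zs)
  pathFree-++ R-sym ys free-ys free-zs unlinked u∈ x∈ w∈ u≢w u≢x w≢x Rux Rxw
    with ∈-++⁻ ys u∈ | ∈-++⁻ ys x∈ | ∈-++⁻ ys w∈
  ... | inj₁ u∈ys | inj₁ x∈ys | inj₁ w∈ys = free-ys u∈ys x∈ys w∈ys u≢w u≢x w≢x Rux Rxw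
  ... | inj₂ u∈zs | inj₂ x∈zs | inj₂ w∈zs = free-zs u∈zs x∈zs w∈zs u≢w u≢x w≢x Rux Rxw
  ... | _         | inj₁ x∈ys | inj₂ w∈zs = unlinked x∈ys w∈zs Rxw
  ... | inj₂ u∈zs | inj₁ x∈ys | _         = unlinked x∈ys u∈zs (R-sym Rux)
  ... | inj₁ u∈ys | inj₂ x∈zs | _         = unlinked u∈ys x∈zs Rux
  ... | _         | inj₂ x∈zs | inj₁ w∈ys = unlinked w∈ys x∈zs (R-sym Rxw)

module _ {A : Set} (_≺_ R : A → A → Set) where

  LinksOnlyConsecutive : List A → Set
  LinksOnlyConsecutive xs = ∀ {x y z} → x ∈ xs → y ∈ xs → z ∈ xs → x ≺ y → y ≺ z → ¬ R x z

  pathFree-dropEveryThird : Symmetric R → ∀ xs → AllPairs _≺_ xs → LinksOnlyConsecutive xs →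
    PathFree R (dropEveryThird xs)
  pathFree-dropEveryThird R-sym (a ∷ b ∷ c ∷ r) ((a≺b ∷ _) ∷ (b≺c ∷ b≺r) ∷ c≺r ∷ sorted) links =
    pathFree-++ R R-sym (a ∷ b ∷ []) (pathFree-[_,_] R a b)
      (pathFree-dropEveryThird R-sym r sorted λ x∈ y∈ z∈ → links (later x∈) (later y∈) (later z∈))
      (λ y∈ z∈ → ab-unlinked-r y∈ (∈-dropEveryThird⁻ r z∈))
    where
      later : ∀ {x} → x ∈ r → x ∈ a ∷ b ∷ c ∷ r
      later x∈ = there (there (there x∈))

      ab-unlinked-r : Unlinked R (a ∷ b ∷ []) r
      ab-unlinked-r (here refl) z∈r =
        links (here refl) (there (here refl)) (later z∈r) a≺b (All.lookup b≺r z∈r)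
      ab-unlinked-r (there (here refl)) z∈r =
        links (there (here refl)) (there (there (here refl))) (later z∈r) b≺c (All.lookup c≺r z∈r)
  pathFree-dropEveryThird _ []           _ _ = pathFree-[] R
  pathFree-dropEveryThird _ (a ∷ [])     _ _ = pathFree-[_] R a
  pathFree-dropEveryThird _ (a ∷ b ∷ []) _ _ = pathFree-[_,_] R a b

length-filter-true : ∀ {A : Set} (f : A → Bool) xs →
  length (filter (λ x → f x ≟ᵇ true) xs) ≡ sum (map (λ x → if f x then 1 else 0) xs)
length-filter-true f [] = refl
length-filter-true f (x ∷ xs) with f x
... | true  = cong suc (length-filter-true f xs)
... | false = length-filter-true f xs

foldr-⊔-attained : ∀ {A : Set} (f : A → ℕ) xs → 0 < foldr (λ x m → f x ⊔ m) 0 xs →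
  ∃ λ x → f x ≡ foldr (λ x m → f x ⊔ m) 0 xs
foldr-⊔-attained f (x ∷ xs) 0<max with ⊔-sel (f x) (foldr (λ x m → f x ⊔ m) 0 xs)
... | inj₁ max≡fx = x , sym max≡fx
... | inj₂ max≡rest with foldr-⊔-attained f xs (subst (0 <_) max≡rest 0<max)
...   | y , fy≡rest = y , trans fy≡rest (sym max≡rest)

fromList : ∀ {n} → List (Fin n) → Subset n
fromList []       = ∅
fromList (x ∷ xs) = ⁅ x ⁆ ∪ fromList xs

∈-fromList⁻ : ∀ {n} {y : Fin n} xs → y ∈ₛ fromList xs → y ∈ xs
∈-fromList⁻ []       y∈ = ⊥-elim (∉⊥ y∈)
∈-fromList⁻ (x ∷ xs) y∈ with x∈p∪q⁻ ⁅ x ⁆ (fromList xs) y∈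
... | inj₁ y∈⁅x⁆ = here (x∈⁅y⁆⇒x≡y x y∈⁅x⁆)
... | inj₂ y∈xs  = there (∈-fromList⁻ xs y∈xs)

length≤∣fromList∣ : ∀ {n} (xs : List (Fin n)) → AllPairs _≢_ xs → length xs ≤ ∣ fromList xs ∣
length≤∣fromList∣ []       _              = z≤n
length≤∣fromList∣ (x ∷ xs) (x∉xs ∷ unique) =
  ≤-trans (s≤s (length≤∣fromList∣ xs unique))
    (p⊂q⇒∣p∣<∣q∣ (q⊆p∪q ⁅ x ⁆ (fromList xs) , x , p⊆p∪q (fromList xs) (x∈⁅x⁆ x) , x∉))
  where
    x∉ : ¬ x ∈ₛ fromList xs
    x∉ x∈ = All.lookup x∉xs (∈-fromList⁻ xs x∈) refl

Adjacent : ∀ {n} → Graph n → Fin n → Fin n → Set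
Adjacent G u v = adj G u v ≡ true

Adjacent-sym : ∀ {n} (G : Graph n) → Symmetric (Adjacent G)
Adjacent-sym G {u} {v} uv = trans (Graph.sym G v u) uv

short-walk-visit⇒adjacent : ∀ {n} {A : Adj n} {u w x k} (p : Walk A u w k) → k ≤ 2 → Visits x p →
  u ≢ x → w ≢ x → A u x ≡ true × A x w ≡ true
short-walk-visit⇒adjacent nil                         _ here-nil                     u≢x _   = ⊥-elim (u≢x refl)
short-walk-visit⇒adjacent (cons _ _)                  _ (here-cons _ _)              u≢x _   = ⊥-elim (u≢x refl)
short-walk-visit⇒adjacent (cons _ nil)                _ (there _ here-nil)           _   w≢x = ⊥-elim (w≢x refl)
short-walk-visit⇒adjacent (cons ux (cons xw nil))     _ (there _ (here-cons _ _))    _   _   = ux , xw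
short-walk-visit⇒adjacent (cons _ (cons _ nil))       _ (there _ (there _ here-nil)) _   w≢x = ⊥-elim (w≢x refl)
short-walk-visit⇒adjacent (cons _ (cons _ (cons _ _))) (s≤s (s≤s ())) _ _ _

generalPosition-pathFree-neighbours : ∀ {n} (G : Graph n) v (S : List (Fin n)) →
  All (Adjacent G v) S → PathFree (Adjacent G) S → GeneralPosition G (fromList S)
generalPosition-pathFree-neighbours G v S adjacent free u w x u∈ w∈ x∈ u≢w u≢x w≢x
  (k , p , shortest , visits) =
  let ux , xw = short-walk-visit⇒adjacent p (shortest 2 u⋯v⋯w) visits u≢x w≢x
  in  free u∈S x∈S w∈S u≢w u≢x w≢x ux xw
  where
    u∈S : u ∈ S
    u∈S = ∈-fromList⁻ S u∈
    w∈S : w ∈ S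
    w∈S = ∈-fromList⁻ S w∈
    x∈S : x ∈ S
    x∈S = ∈-fromList⁻ S x∈
    u⋯v⋯w : Walk (adj G) u w 2
    u⋯v⋯w = cons (Adjacent-sym G (All.lookup adjacent u∈S)) (cons (All.lookup adjacent w∈S) nil)

module CyclicOrder {n} (G : Graph n) (π : Fin n → Fin n) (π-injective : Injective _≡_ _≡_ π)
  (noncrossing : ∀ a b c d → Adjacent G a b → Adjacent G c d →
                 ¬ (π a <ᶠ π c × π c <ᶠ π b × π b <ᶠ π d))
  (v : Fin n) where

  pos : Fin n → ℕ
  pos u = toℕ (π u)

  -- Position on the circle counted from just after v, so that v itself comes last.
  key : Fin n → ℕ
  key u = if pos v <ᵇ pos u then pos u else n + pos u

  data Side (u : Fin n) : ℕ → Set where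
    after  : pos v < pos u → Side u (pos u)
    before : pos u ≤ pos v → Side u (n + pos u)

  side : ∀ u → Side u (key u)
  side u with pos v <ᵇ pos u | <ᵇ-reflects-< (pos v) (pos u)
  ... | true  | ofʸ v<u = after v<u
  ... | false | ofⁿ v≮u = before (≮⇒≥ v≮u)

  pos-injective : ∀ {x y} → pos x ≡ pos y → x ≡ y
  pos-injective eq = π-injective (toℕ-injective eq)

  after<before : ∀ x y → pos x < n + pos y
  after<before x y = <-≤-trans (toℕ<n (π x)) (m≤m+n n (pos y))

  key-injective : ∀ {x y} → key x ≡ key y → x ≡ y
  key-injective {x} {y} kx≡ky with key x | side x | key y | side y
  ... | _ | after  _ | _ | after  _ = pos-injective kx≡ky
  ... | _ | before _ | _ | before _ = pos-injective (+-cancelˡ-≡ n _ _ kx≡ky)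
  ... | _ | after  _ | _ | before _ = ⊥-elim (<-irrefl kx≡ky (after<before x y))
  ... | _ | before _ | _ | after  _ = ⊥-elim (<-irrefl (sym kx≡ky) (after<before y x))

  v≢neighbour : ∀ {u} → Adjacent G v u → v ≢ u
  v≢neighbour vu refl with trans (sym vu) (irrefl G v)
  ... | ()

  before-neighbour : ∀ {u} → Adjacent G v u → pos u ≤ pos v → pos u < pos v
  before-neighbour vu u≤v = ≤∧≢⇒< u≤v λ u≡v → v≢neighbour vu (pos-injective (sym u≡v))

  -- In cyclic order x, y, z, v the chord xz would cross the spoke vy.
  spoke-blocks-chord : ∀ {x y z} → Adjacent G v x → Adjacent G v y → Adjacent G v z →
    key x < key y → key y < key z → ¬ Adjacent G x z
  spoke-blocks-chord {x} {y} {z} vx vy vz x<y y<z xz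
    with key x | side x | key y | side y | key z | side z
  ... | _ | after v<x | _ | after _  | _ | after _ =
    noncrossing v y x z vy xz (v<x , x<y , y<z)
  ... | _ | after v<x | _ | after _  | _ | before z≤v =
    noncrossing z x v y (Adjacent-sym G xz) vy (before-neighbour vz z≤v , v<x , x<y)
  ... | _ | after v<x | _ | before _ | _ | before z≤v =
    noncrossing y v z x (Adjacent-sym G vy) (Adjacent-sym G xz)
      (+-cancelˡ-< n _ _ y<z , before-neighbour vz z≤v , v<x)
  ... | _ | before _  | _ | before _ | _ | before z≤v =
    noncrossing x z y v xz (Adjacent-sym G vy)
      (+-cancelˡ-< n _ _ x<y , +-cancelˡ-< n _ _ y<z , before-neighbour vz z≤v)
  ... | _ | _         | _ | before _ | _ | after _ = <-asym y<z (after<before z y)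
  ... | _ | before _  | _ | after _  | _ | _       = <-asym x<y (after<before y x)

  open Sort (On.decTotalOrder ≤-decTotalOrder key) using (sort; sort-↭; sort-↗)

  neighbours : List (Fin n)
  neighbours = sort (filter (λ u → adj G v u ≟ᵇ true) (allFin n))

  length-neighbours : length neighbours ≡ deg G v
  length-neighbours = trans (↭-length (sort-↭ _)) (length-filter-true (adj G v) (allFin n))

  neighbours-adjacent : All (Adjacent G v) neighbours
  neighbours-adjacent =
    All-resp-↭ (↭-sym (sort-↭ _)) (all-filter (λ u → adj G v u ≟ᵇ true) (allFin n))

  neighbours-unique : AllPairs _≢_ neighbours
  neighbours-unique =
    Unique-resp-↭ (setoid (Fin n)) (↭⇒↭ₛ (↭-sym (sort-↭ _))) (filter⁺ _ (allFin⁺ n))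

  neighbours-increasing : AllPairs (λ x y → key x < key y) neighbours
  neighbours-increasing = AllPairs.zipWith
    (λ (kx≤ky , x≢y) → ≤∧≢⇒< kx≤ky (λ kx≡ky → x≢y (key-injective kx≡ky)))
    (Linked⇒AllPairs ≤-trans (sort-↗ _) , neighbours-unique)

  neighbours-linkOnlyConsecutive :
    LinksOnlyConsecutive (λ x y → key x < key y) (Adjacent G) neighbours
  neighbours-linkOnlyConsecutive x∈ y∈ z∈ =
    spoke-blocks-chord (adjacent x∈) (adjacent y∈) (adjacent z∈)
    where
      adjacent : ∀ {u} → u ∈ neighbours → Adjacent G v u
      adjacent = All.lookup neighbours-adjacent

gp≥-outerplanar-degree : ∀ {n} (G : Graph n) → Outerplanar (adj G) → ∀ v →
  gp≥ G (2 * suc (deg G v) / 3)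
gp≥-outerplanar-degree {n} G (π , π-injective , noncrossing) v =
  fromList S ,
  generalPosition-pathFree-neighbours G v S (All-dropEveryThird neighbours neighbours-adjacent) S-pathFree ,
  S-large
  where
    open CyclicOrder G π π-injective noncrossing v

    S : List (Fin n)
    S = dropEveryThird neighbours

    S-pathFree : PathFree (Adjacent G) S
    S-pathFree = pathFree-dropEveryThird _ _ (Adjacent-sym G) neighbours
      neighbours-increasing neighbours-linkOnlyConsecutive

    S-unique : AllPairs _≢_ S
    S-unique = AllPairs-dropEveryThird neighbours neighbours-unique

    S-large : 2 * suc (deg G v) / 3 ≤ ∣ fromList S ∣
    S-large = begin
      2 * suc (deg G v) / 3           ≡⟨ cong (λ d → 2 * suc d / 3) length-neighbours ⟨
      2 * suc (length neighbours) / 3 ≤⟨ length-dropEveryThird neighbours ⟩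
      length S                        ≤⟨ length≤∣fromList∣ S S-unique ⟩
      ∣ fromList S ∣                  ∎
      where open ≤-Reasoning

mainTheorem1 : ∀ {n} (G : Graph n) → Connected G → MaximalOuterplanar G →
    2 ≤ maxDeg G → gp≥ G ((2 * suc (maxDeg G)) / 3)
mainTheorem1 {n} G _ (outerplanar , _) 2≤Δ =
  let v , deg-v≡Δ = foldr-⊔-attained (deg G) (allFin n) (<-≤-trans (s≤s z≤n) 2≤Δ)
  in  subst (λ d → gp≥ G (2 * suc d / 3)) deg-v≡Δ (gp≥-outerplanar-degree G outerplanar v)
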